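{- Every Girard algebra (respectively, bounded Girard algebra) is embeddable in the Girard-algebra reduct of a girale (respectively, bounded girale). Hence the variety of (bounded) Girard algebras is exactly the class of subalgebras of Girard-algebra reducts of (bounded) girales, and $\mathsf{LL}$ is a conservative extension of $\mathsf{MALL}$.
   Context: A commutative residuated lattice is $\langle A,\vee,\wedge,\to,\cdot,1\rangle$ with $\langle A,\vee,\wedge\rangle$ a lattice, $\langle A,\cdot,1\rangle$ a commutative monoid, and $x\cdot y\le z$ iff $x\le y\to z$. A Girard algebra is a commutative residuated lattice with a constant $0$ with $(b\to 0)\to 0=b$ for all $b$; $\neg x:=x\to 0$. A bounded Girard algebra additionally has a constant $\top$ with $x\to\top\ge 1$ for all $x$, and $\bot:=\neg\top$. A girale is a Girard algebra with a unary operation $!$ satisfying (G1) $!1=1$; (G2) $!a\le a\wedge 1$; (G3) $!a\cdot !b=!(a\wedge b)$; (G4) $!!a=!a$; a bounded girale is a girale that is also a bounded Girard algebra. $\mathsf{MALL}$ is the Hilbert-style system in the language $\to,\cdot,\wedge,\vee,\neg,0,1,\top,\bot$ with axioms (HL1) $p\to p$; (HL2) $(p\to q)\to((q\to r)\to(p\to r))$; (HL3) $(p\to(q\to r))\to(q\to(p\to r))$; (HL4) $\neg\neg p\to p$; (HL5) $(p\to\neg q)\to(q\to\neg p)$; (HL6) $p\to(q\to p\cdot q)$; (HL7) $(p\to(q\to r))\to(p\cdot q\to r)$; (HL8) $1$; (HL9) $1\to(p\to p)$; (HL10) $p\to(\neg p\to 0)$; (HL11) $\neg 0$; (HL12) $p\wedge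 q\to p$; (HL13) $p\wedge q\to q$; (HL14) $(p\to q)\wedge(p\to r)\to(p\to q\wedge r)$; (HL15) $p\to p\vee q$; (HL16) $q\to p\vee q$; (HL17) $(p\to r)\wedge(q\to r)\to(p\vee q\to r)$; (HL18) $p\to\top$; (HL19) $\bot\to p$, and rules (MP) from $p,p\to q$ infer $q$, (Adj) from $p,q$ infer $p\wedge q$. $\mathsf{LL}$ is obtained by adding the unary connective $!$, the axioms (HL20) $q\to(!p\to q)$; (HL21) $(!p\to(!p\to q))\to(!p\to q)$; (HL22) $!(p\to q)\to(!p\to !q)$; (HL23) $!p\to p$; (HL24) $!p\to !!p$, and the rule (Nec) from $p$ infer $!p$. Conservative extension means: for every set $\Gamma\cup\{\varphi\}$ of $\mathsf{MALL}$-formulas, $\Gamma\vdash_{\mathsf{LL}}\varphi$ iff $\Gamma\vdash_{\mathsf{MALL}}\varphi$. -}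

module Defs where

open import Level using (Level; _⊔_; suc)
open import Data.Nat using (ℕ)
open import Data.Bool using (Bool; true; false)
open import Data.Product using (Σ; _×_; _,_; ∃)
open import Relation.Binary.PropositionalEquality using (_≡_)
open import Algebra.Core using (Op₂)
open import Algebra.Definitions using (Congruent₂)
open import Algebra.Structures using (IsCommutativeMonoid)
open import Algebra.Lattice.Structures using (IsLattice)

private variable a ℓ b m : Level

record GirardOps (a ℓ : Level) : Set (suc (a ⊔ ℓ)) where
  infix  4 _≈_ _≤_
  infixr 5 _⇒_
  infixl 6 _∨_
  infixl 7 _∧_
  infixl 8 _·_
  field
    Carrier : Set a
    _≈_     : Carrier → Carrier → Set ℓ
    _∨_ _∧_ : Op₂ Carrier
    _⇒_     : Op₂ Carrier
    _·_     : Op₂ Carrier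
    1# 0#   : Carrier

  _≤_ : Carrier → Carrier → Set ℓ
  x ≤ y = (x ∧ y) ≈ x

  ¬_ : Carrier → Carrier
  ¬ x = x ⇒ 0#

record IsGirard (O : GirardOps a ℓ) : Set (a ⊔ ℓ) where
  open GirardOps O
  field
    isLattice           : IsLattice _≈_ _∨_ _∧_
    isCommutativeMonoid : IsCommutativeMonoid _≈_ _·_ 1#
    ⇒-cong              : Congruent₂ _≈_ _⇒_
    residuation         : ∀ x y z → (x · y ≤ z → x ≤ y ⇒ z) × (x ≤ y ⇒ z → x · y ≤ z)
    involutive          : ∀ x → (x ⇒ 0#) ⇒ 0# ≈ x

record BGirardOps (a ℓ : Level) : Set (suc (a ⊔ ℓ)) where
  field
    ops : GirardOps a ℓ
  open GirardOps ops
  field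
    ⊤# : Carrier

record IsBGirard (B : BGirardOps a ℓ) : Set (a ⊔ ℓ) where
  open BGirardOps B
  open GirardOps ops
  field
    isGirard : IsGirard ops
    top      : ∀ x → 1# ≤ x ⇒ ⊤#

record Girale (a ℓ : Level) : Set (suc (a ⊔ ℓ)) where
  field
    ops      : GirardOps a ℓ
    isGirard : IsGirard ops
  open GirardOps ops
  field
    !      : Carrier → Carrier
    !-cong : ∀ {x y} → x ≈ y → ! x ≈ ! y
    G1     : ! 1# ≈ 1#
    G2     : ∀ x → ! x ≤ x ∧ 1#
    G3     : ∀ x y → ! x · ! y ≈ ! (x ∧ y)
    G4     : ∀ x → ! (! x) ≈ ! x

reduct : Girale a ℓ → GirardOps a ℓ
reduct G = Girale.ops G

record BGirale (a ℓ : Level) : Set (suc (a ⊔ ℓ)) where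
  field
    girale : Girale a ℓ
  open Girale girale
  open GirardOps ops
  field
    ⊤#  : Carrier
    top : ∀ x → 1# ≤ x ⇒ ⊤#

breduct : BGirale a ℓ → BGirardOps a ℓ
breduct G = record { ops = Girale.ops (BGirale.girale G) ; ⊤# = BGirale.⊤# G }

record Embedding (A : GirardOps a ℓ) (B : GirardOps b m) : Set (a ⊔ ℓ ⊔ b ⊔ m) where
  private
    module A = GirardOps A
    module B = GirardOps B
  field
    f         : A.Carrier → B.Carrier
    f-cong    : ∀ {x y} → x A.≈ y → f x B.≈ f y
    injective : ∀ {x y} → f x B.≈ f y → x A.≈ y
    f-∨       : ∀ x y → f (x A.∨ y) B.≈ f x B.∨ f y
    f-∧       : ∀ x y → f (x A.∧ y) B.≈ f x B.∧ f y
    f-⇒       : ∀ x y → f (x A.⇒ y) B.≈ (f x B.⇒ f y)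
    f-·       : ∀ x y → f (x A.· y) B.≈ f x B.· f y
    f-1       : f A.1# B.≈ B.1#
    f-0       : f A.0# B.≈ B.0#

record BEmbedding (A : BGirardOps a ℓ) (B : BGirardOps b m) : Set (a ⊔ ℓ ⊔ b ⊔ m) where
  private
    module A = BGirardOps A
    module B = BGirardOps B
  field
    embedding : Embedding A.ops B.ops
  open Embedding embedding
  field
    f-⊤ : GirardOps._≈_ B.ops (f A.⊤#) B.⊤#

-- Formulas; index true = LL language (with !), false = MALL language
data Fm : Bool → Set where
  var          : ∀ {β} → ℕ → Fm β
  `0 `1 `⊤ `⊥  : ∀ {β} → Fm β
  `¬_          : ∀ {β} → Fm β → Fm β
  _`→_ _`·_ _`∧_ _`∨_ : ∀ {β} → Fm β → Fm β → Fm β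
  `!_          : Fm true → Fm true

infixr 4 _`→_
infixl 6 _`∨_
infixl 7 _`∧_
infixl 8 _`·_
infix  9 `¬_ `!_

ι : Fm false → Fm true
ι (var n)   = var n
ι `0        = `0
ι `1        = `1
ι `⊤        = `⊤
ι `⊥        = `⊥
ι (`¬ p)    = `¬ ι p
ι (p `→ q)  = ι p `→ ι q
ι (p `· q)  = ι p `· ι q
ι (p `∧ q)  = ι p `∧ ι q
ι (p `∨ q)  = ι p `∨ ι q

data Axiom : ∀ {β} → Fm β → Set where
  HL1  : ∀ {β} (p : Fm β) → Axiom (p `→ p)
  HL2  : ∀ {β} (p q r : Fm β) → Axiom ((p `→ q) `→ ((q `→ r) `→ (p `→ r)))
  HL3  : ∀ {β} (p q r : Fm β) → Axiom ((p `→ (q `→ r)) `→ (q `→ (p `→ r)))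
  HL4  : ∀ {β} (p : Fm β) → Axiom (`¬ `¬ p `→ p)
  HL5  : ∀ {β} (p q : Fm β) → Axiom ((p `→ `¬ q) `→ (q `→ `¬ p))
  HL6  : ∀ {β} (p q : Fm β) → Axiom (p `→ (q `→ p `· q))
  HL7  : ∀ {β} (p q r : Fm β) → Axiom ((p `→ (q `→ r)) `→ (p `· q `→ r))
  HL8  : ∀ {β} → Axiom {β} `1
  HL9  : ∀ {β} (p : Fm β) → Axiom (`1 `→ (p `→ p))
  HL10 : ∀ {β} (p : Fm β) → Axiom (p `→ (`¬ p `→ `0))
  HL11 : ∀ {β} → Axiom {β} (`¬ `0)
  HL12 : ∀ {β} (p q : Fm β) → Axiom (p `∧ q `→ p)
  HL13 : ∀ {β} (p q : Fm β) → Axiom (p `∧ q `→ q)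
  HL14 : ∀ {β} (p q r : Fm β) → Axiom ((p `→ q) `∧ (p `→ r) `→ (p `→ q `∧ r))
  HL15 : ∀ {β} (p q : Fm β) → Axiom (p `→ p `∨ q)
  HL16 : ∀ {β} (p q : Fm β) → Axiom (q `→ p `∨ q)
  HL17 : ∀ {β} (p q r : Fm β) → Axiom ((p `→ r) `∧ (q `→ r) `→ (p `∨ q `→ r))
  HL18 : ∀ {β} (p : Fm β) → Axiom (p `→ `⊤)
  HL19 : ∀ {β} (p : Fm β) → Axiom (`⊥ `→ p)
  HL20 : (p q : Fm true) → Axiom (q `→ (`! p `→ q))
  HL21 : (p q : Fm true) → Axiom ((`! p `→ (`! p `→ q)) `→ (`! p `→ q))
  HL22 : (p q : Fm true) → Axiom (`! (p `→ q) `→ (`! p `→ `! q))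
  HL23 : (p : Fm true) → Axiom (`! p `→ p)
  HL24 : (p : Fm true) → Axiom (`! p `→ `! `! p)

data _⊢MALL_ {γ : Level} (Γ : Fm false → Set γ) : Fm false → Set γ where
  ax  : ∀ {φ} → Axiom φ → Γ ⊢MALL φ
  hyp : ∀ {φ} → Γ φ → Γ ⊢MALL φ
  mp  : ∀ {φ ψ} → Γ ⊢MALL φ → Γ ⊢MALL (φ `→ ψ) → Γ ⊢MALL ψ
  adj : ∀ {φ ψ} → Γ ⊢MALL φ → Γ ⊢MALL ψ → Γ ⊢MALL (φ `∧ ψ)

data _⊢LL_ {γ : Level} (Γ : Fm true → Set γ) : Fm true → Set γ where
  ax  : ∀ {φ} → Axiom φ → Γ ⊢LL φ
  hyp : ∀ {φ} → Γ φ → Γ ⊢LL φ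
  mp  : ∀ {φ ψ} → Γ ⊢LL φ → Γ ⊢LL (φ `→ ψ) → Γ ⊢LL ψ
  adj : ∀ {φ ψ} → Γ ⊢LL φ → Γ ⊢LL ψ → Γ ⊢LL (φ `∧ ψ)
  nec : ∀ {φ} → Γ ⊢LL φ → Γ ⊢LL (`! φ)

infix 3 _⊢MALL_ _⊢LL_

ιSet : ∀ {γ} → (Fm false → Set γ) → Fm true → Set γ
ιSet Γ ψ = ∃ λ γ → Γ γ × ι γ ≡ ψ

{-# OPTIONS --safe #-}
-- A Girard algebra A embeds, by a ↦ ↓a, into a phase-space girale: predicates on A, where
-- x ⊥ y means x · y ≤ 0 and predicates are ordered by inclusion of their biorthogonal
-- closures; the exponential !X is ↓1 if 1 lies in the closure of X and empty otherwise.
-- Conversely, an injective homomorphism preserves and reflects the order, so the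
-- Girard-algebra laws pull back along it. For conservativity, an LL derivation of ι φ from
-- ι Γ is sound in every bounded girale; in the phase girale over the Lindenbaum algebra of Γ
-- the formula ι φ denotes ↓ φ, and since ↓ reflects the order, validity there gives
-- Γ ⊢ 1 → φ in MALL.
module Submission where

open import Defs
open import Level using (Level; _⊔_; suc; Lift; lift; 0ℓ)
open import Data.Bool using (true; false)
open import Data.Nat using (ℕ)
open import Data.Product using (Σ; _×_; _,_; proj₁; proj₂; ∃)
open import Data.Sum using (inj₁; inj₂; [_,_])
open import Relation.Unary using (Pred; _⊆_; _∪_)
open import Function.Bundles using (_⇔_; mk⇔)
open import Relation.Binary.PropositionalEquality using (refl)
open import Relation.Binary.Construct.Interior.Symmetric as SymInterior
  using (SymInterior; _,_; rhs≤lhs)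
open import Algebra.Core using (Op₂)
open import Algebra.Structures using (IsCommutativeMonoid)
open import Algebra.Lattice.Structures using (IsLattice)
open import Algebra.Lattice.Bundles using (Lattice)
import Algebra.Lattice.Properties.Lattice as LatticeProperties
import Relation.Binary.Lattice as OrderLattice
import Relation.Binary.Lattice.Properties.Lattice as OrderLatticeProperties
import Algebra.Lattice.Morphism.LatticeMonomorphism as LatticeMonomorphism
import Algebra.Morphism.MonoidMonomorphism as MonoidMonomorphism
open import Algebra.Lattice.Morphism.Structures using (IsLatticeMonomorphism)
open import Algebra.Morphism.Structures using (IsMonoidMonomorphism)

record GirardPreorder (c ℓ : Level) : Set (suc (c ⊔ ℓ)) where
  infix  4 _⊑_
  infixr 5 _⇒_
  infixl 6 _∨_
  infixl 7 _∧_
  infixl 8 _·_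
  field
    Carrier        : Set c
    _⊑_            : Carrier → Carrier → Set ℓ
    _∨_ _∧_ _⇒_ _·_ : Op₂ Carrier
    1# 0#          : Carrier
    ⊑-refl         : ∀ {x} → x ⊑ x
    ⊑-trans        : ∀ {x y z} → x ⊑ y → y ⊑ z → x ⊑ z
    x⊑x∨y          : ∀ x y → x ⊑ x ∨ y
    y⊑x∨y          : ∀ x y → y ⊑ x ∨ y
    ∨-least        : ∀ {x y z} → x ⊑ z → y ⊑ z → x ∨ y ⊑ z
    x∧y⊑x          : ∀ x y → x ∧ y ⊑ x
    x∧y⊑y          : ∀ x y → x ∧ y ⊑ y
    ∧-greatest     : ∀ {x y z} → z ⊑ x → z ⊑ y → z ⊑ x ∧ y
    ·-monoˡ        : ∀ {x x′} y → x ⊑ x′ → x · y ⊑ x′ · y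
    ·-comm         : ∀ x y → x · y ⊑ y · x
    ·-assocʳ       : ∀ x y z → (x · y) · z ⊑ x · (y · z)
    ·-assocˡ       : ∀ x y z → x · (y · z) ⊑ (x · y) · z
    1·x⊑x          : ∀ x → 1# · x ⊑ x
    x⊑1·x          : ∀ x → x ⊑ 1# · x
    residual-intro : ∀ {x y z} → x · y ⊑ z → x ⊑ y ⇒ z
    residual-elim  : ∀ {x y z} → x ⊑ y ⇒ z → x · y ⊑ z
    ¬¬-elim        : ∀ x → (x ⇒ 0#) ⇒ 0# ⊑ x

module GirardPreorderProperties {c ℓ} (R : GirardPreorder c ℓ) where
  open GirardPreorder R public

  infixr 4 _⨾_
  _⨾_ : ∀ {x y z} → x ⊑ y → y ⊑ z → x ⊑ z
  _⨾_ = ⊑-trans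

  infix 4 _≈_
  _≈_ : Carrier → Carrier → Set ℓ
  _≈_ = SymInterior _⊑_

  ≈-refl : ∀ {x} → x ≈ x
  ≈-refl = ⊑-refl , ⊑-refl

  ·-monoʳ : ∀ x {y y′} → y ⊑ y′ → x · y ⊑ x · y′
  ·-monoʳ x {y} {y′} y⊑y′ = ·-comm x y ⨾ ·-monoˡ x y⊑y′ ⨾ ·-comm y′ x

  ·-mono : ∀ {x x′ y y′} → x ⊑ x′ → y ⊑ y′ → x · y ⊑ x′ · y′
  ·-mono {x′ = x′} {y = y} x⊑x′ y⊑y′ = ·-monoˡ y x⊑x′ ⨾ ·-monoʳ x′ y⊑y′

  x·1⊑x : ∀ x → x · 1# ⊑ x
  x·1⊑x x = ·-comm x 1# ⨾ 1·x⊑x x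

  x⊑x·1 : ∀ x → x ⊑ x · 1#
  x⊑x·1 x = x⊑1·x x ⨾ ·-comm 1# x

  ·-swapʳ : ∀ x y z → (x · y) · z ⊑ (x · z) · y
  ·-swapʳ x y z = ·-assocʳ x y z ⨾ ·-monoʳ x (·-comm y z) ⨾ ·-assocˡ x z y

  ·-rotate : ∀ x y z → (x · y) · z ⊑ (z · x) · y
  ·-rotate x y z = ·-comm (x · y) z ⨾ ·-assocˡ z x y

  eval : ∀ x y → (x ⇒ y) · x ⊑ y
  eval x y = residual-elim ⊑-refl

  ⇒-mono : ∀ {x x′ y y′} → x′ ⊑ x → y ⊑ y′ → x ⇒ y ⊑ x′ ⇒ y′
  ⇒-mono {x} {y = y} x′⊑x y⊑y′ = residual-intro (·-monoʳ _ x′⊑x ⨾ eval x y ⨾ y⊑y′)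

  ⇒-exchange : ∀ x y z → x ⇒ (y ⇒ z) ⊑ y ⇒ (x ⇒ z)
  ⇒-exchange x y z =
    residual-intro (residual-intro (·-swapʳ _ y x ⨾ ·-monoˡ y (eval x _) ⨾ eval y z))

  ·-distribˡ-∨ : ∀ x y z → x · (y ∨ z) ⊑ x · y ∨ x · z
  ·-distribˡ-∨ x y z = ·-comm x _ ⨾ residual-elim (∨-least
    (residual-intro (·-comm y x ⨾ x⊑x∨y _ _)) (residual-intro (·-comm z x ⨾ y⊑x∨y _ _)))

  ¬¬-intro : ∀ x → x ⊑ (x ⇒ 0#) ⇒ 0#
  ¬¬-intro x = residual-intro (·-comm x _ ⨾ eval x 0#)

  internalise : ∀ {x y} → x ⊑ y → 1# ⊑ x ⇒ y
  internalise x⊑y = residual-intro (1·x⊑x _ ⨾ x⊑y)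

  externalise : ∀ {x y} → 1# ⊑ x ⇒ y → x ⊑ y
  externalise 1⊑x⇒y = x⊑1·x _ ⨾ residual-elim 1⊑x⇒y

module GirardPreorderQuotient {c ℓ} (R : GirardPreorder c ℓ) where
  open GirardPreorderProperties R

  girardOps : GirardOps c ℓ
  girardOps = record
    { Carrier = Carrier ; _≈_ = _≈_ ; _∨_ = _∨_ ; _∧_ = _∧_ ; _⇒_ = _⇒_
    ; _·_ = _·_ ; 1# = 1# ; 0# = 0# }

  open GirardOps girardOps public using (_≤_)

  ≤⇒⊑ : ∀ {x y} → x ≤ y → x ⊑ y
  ≤⇒⊑ {x} {y} x∧y≈x = rhs≤lhs x∧y≈x ⨾ x∧y⊑y x y

  ⊑⇒≤ : ∀ {x y} → x ⊑ y → x ≤ y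
  ⊑⇒≤ {x} {y} x⊑y = x∧y⊑x x y , ∧-greatest ⊑-refl x⊑y

  orderLattice : OrderLattice.Lattice c ℓ ℓ
  orderLattice = record
    { Carrier = Carrier ; _≈_ = _≈_ ; _≤_ = _⊑_ ; _∨_ = _∨_ ; _∧_ = _∧_
    ; isLattice = record
      { isPartialOrder = SymInterior.isPartialOrder ⊑-refl ⊑-trans
      ; supremum = λ x y → x⊑x∨y x y , y⊑x∨y x y , λ _ → ∨-least
      ; infimum  = λ x y → x∧y⊑x x y , x∧y⊑y x y , λ _ → ∧-greatest
      }
    }

  isCommutativeMonoid : IsCommutativeMonoid _≈_ _·_ 1#
  isCommutativeMonoid = record
    { isMonoid = record
      { isSemigroup = record
        { isMagma = record
          { isEquivalence = SymInterior.isEquivalence ⊑-refl ⊑-trans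
          ; ∙-cong = λ (x⊑x′ , x′⊑x) (y⊑y′ , y′⊑y) → ·-mono x⊑x′ y⊑y′ , ·-mono x′⊑x y′⊑y }
        ; assoc = λ x y z → ·-assocʳ x y z , ·-assocˡ x y z }
      ; identity = (λ x → 1·x⊑x x , x⊑1·x x) , (λ x → x·1⊑x x , x⊑x·1 x) }
    ; comm = λ x y → ·-comm x y , ·-comm y x }

  isGirard : IsGirard girardOps
  isGirard = record
    { isLattice = OrderLatticeProperties.isAlgLattice orderLattice
    ; isCommutativeMonoid = isCommutativeMonoid
    ; ⇒-cong = λ (x⊑x′ , x′⊑x) (y⊑y′ , y′⊑y) → ⇒-mono x′⊑x y⊑y′ , ⇒-mono x⊑x′ y′⊑y
    ; residuation = λ x y z → (λ xy≤z → ⊑⇒≤ (residual-intro (≤⇒⊑ xy≤z)))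
                            , (λ x≤y⇒z → ⊑⇒≤ (residual-elim (≤⇒⊑ x≤y⇒z)))
    ; involutive = λ x → ¬¬-elim x , ¬¬-intro x
    }

module GirardAlgebraOrder {a ℓ} (A : GirardOps a ℓ) (isGirard : IsGirard A) where
  open GirardOps A
  open IsGirard isGirard
  open IsLattice isLattice using (sym)
  open IsCommutativeMonoid isCommutativeMonoid using (assoc; comm; identityˡ)

  private
    lattice : Lattice a ℓ
    lattice = record { isLattice = isLattice }

    -- The library orders a lattice by x ≈ x ∧ y, the converse equation.
    module O = OrderLattice.IsLattice (LatticeProperties.∨-∧-isOrderTheoreticLattice lattice)

  ≤-refl : ∀ {x} → x ≤ x
  ≤-refl = sym O.refl

  ≤-trans : ∀ {x y z} → x ≤ y → y ≤ z → x ≤ z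
  ≤-trans x≤y y≤z = sym (O.trans (sym x≤y) (sym y≤z))

  ≈⇒≤ : ∀ {x y} → x ≈ y → x ≤ y
  ≈⇒≤ x≈y = sym (O.reflexive x≈y)

  ≤-antisym : ∀ {x y} → x ≤ y → y ≤ x → x ≈ y
  ≤-antisym x≤y y≤x = O.antisym (sym x≤y) (sym y≤x)

  ≤-resp-≈ : ∀ {x x′ y y′} → x ≈ x′ → y ≈ y′ → x ≤ y → x′ ≤ y′
  ≤-resp-≈ x≈x′ y≈y′ x≤y = sym (proj₁ O.≤-resp-≈ y≈y′ (proj₂ O.≤-resp-≈ x≈x′ (sym x≤y)))

  girardPreorder : GirardPreorder a ℓ
  girardPreorder = record
    { Carrier = Carrier ; _⊑_ = _≤_ ; _∨_ = _∨_ ; _∧_ = _∧_ ; _⇒_ = _⇒_ ; _·_ = _·_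
    ; 1# = 1# ; 0# = 0# ; ⊑-refl = ≤-refl ; ⊑-trans = ≤-trans
    ; x⊑x∨y = λ x y → sym (O.x≤x∨y x y)
    ; y⊑x∨y = λ x y → sym (O.y≤x∨y x y)
    ; ∨-least = λ x≤z y≤z → sym (O.∨-least (sym x≤z) (sym y≤z))
    ; x∧y⊑x = λ x y → sym (O.x∧y≤x x y)
    ; x∧y⊑y = λ x y → sym (O.x∧y≤y x y)
    ; ∧-greatest = λ z≤x z≤y → sym (O.∧-greatest (sym z≤x) (sym z≤y))
    ; ·-monoˡ = λ y x≤x′ → proj₂ (residuation _ y _) (≤-trans x≤x′ (proj₁ (residuation _ y _) ≤-refl))
    ; ·-comm = λ x y → ≈⇒≤ (comm x y)
    ; ·-assocʳ = λ x y z → ≈⇒≤ (assoc x y z)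
    ; ·-assocˡ = λ x y z → ≈⇒≤ (sym (assoc x y z))
    ; 1·x⊑x = λ x → ≈⇒≤ (identityˡ x)
    ; x⊑1·x = λ x → ≈⇒≤ (sym (identityˡ x))
    ; residual-intro = proj₁ (residuation _ _ _)
    ; residual-elim = proj₂ (residuation _ _ _)
    ; ¬¬-elim = λ x → ≈⇒≤ (involutive x)
    }

module EmbeddingProperties {a ℓ b m} {A : GirardOps a ℓ} {B : GirardOps b m}
                           (e : Embedding A B) (isGirardB : IsGirard B) where
  private
    module A = GirardOps A
    module B = GirardOps B
    module B≤ = GirardAlgebraOrder B isGirardB
    module B⊑ = GirardPreorder B≤.girardPreorder
  open Embedding e
  open IsGirard isGirardB
  open IsLattice isLattice using (sym; trans) renaming (refl to ≈-refl)

  f-mono : ∀ {x y} → x A.≤ y → f x B.≤ f y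
  f-mono {x} {y} x≤y = trans (sym (f-∧ x y)) (f-cong x≤y)

  f-reflects-≤ : ∀ {x y} → f x B.≤ f y → x A.≤ y
  f-reflects-≤ {x} {y} fx≤fy = injective (trans (f-∧ x y) fx≤fy)

  f-¬ : ∀ x → f (A.¬ x) B.≈ B.¬ f x
  f-¬ x = trans (f-⇒ x A.0#) (⇒-cong ≈-refl f-0)

  residual-intro : ∀ {x y z} → x A.· y A.≤ z → x A.≤ y A.⇒ z
  residual-intro {x} {y} {z} xy≤z = f-reflects-≤ (B≤.≤-resp-≈ ≈-refl (sym (f-⇒ y z))
    (B⊑.residual-intro (B≤.≤-resp-≈ (f-· x y) ≈-refl (f-mono xy≤z))))

  residual-elim : ∀ {x y z} → x A.≤ y A.⇒ z → x A.· y A.≤ z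
  residual-elim {x} {y} {z} x≤y⇒z = f-reflects-≤ (B≤.≤-resp-≈ (sym (f-· x y)) ≈-refl
    (B⊑.residual-elim (B≤.≤-resp-≈ ≈-refl (f-⇒ y z) (f-mono x≤y⇒z))))

  isGirard : IsGirard A
  isGirard = record
    { isLattice = LatticeMonomorphism.isLattice isLatticeMonomorphism isLattice
    ; isCommutativeMonoid =
        MonoidMonomorphism.isCommutativeMonoid isMonoidMonomorphism isCommutativeMonoid
    ; ⇒-cong = λ x≈x′ y≈y′ → injective
        (trans (f-⇒ _ _) (trans (⇒-cong (f-cong x≈x′) (f-cong y≈y′)) (sym (f-⇒ _ _))))
    ; residuation = λ x y z → residual-intro , residual-elim
    ; involutive = λ x → injective
        (trans (f-¬ (A.¬ x)) (trans (⇒-cong (f-¬ x) ≈-refl) (involutive (f x))))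
    }
    where
    isLatticeMonomorphism : IsLatticeMonomorphism _ _ f
    isLatticeMonomorphism = record
      { isLatticeHomomorphism = record
        { isRelHomomorphism = record { cong = f-cong } ; ∧-homo = f-∧ ; ∨-homo = f-∨ }
      ; injective = injective }

    isMonoidMonomorphism : IsMonoidMonomorphism _ _ f
    isMonoidMonomorphism = record
      { isMonoidHomomorphism = record
        { isMagmaHomomorphism = record { isRelHomomorphism = record { cong = f-cong } ; homo = f-· }
        ; ε-homo = f-1 }
      ; injective = injective }

embedding⇒isGirard : ∀ {a ℓ b m} {A : GirardOps a ℓ} (G : Girale b m) →
                     Embedding A (reduct G) → IsGirard A
embedding⇒isGirard G e = EmbeddingProperties.isGirard e (Girale.isGirard G)

bembedding⇒isBGirard : ∀ {a ℓ b m} {B : BGirardOps a ℓ} (G : BGirale b m) →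
                       BEmbedding B (breduct G) → IsBGirard B
bembedding⇒isBGirard G e = record
  { isGirard = E.isGirard
  ; top = λ x → E.f-reflects-≤ (G≤.≤-resp-≈ (sym f-1)
      (trans (⇒-cong ≈-refl (sym (BEmbedding.f-⊤ e))) (sym (f-⇒ x _)))
      (BGirale.top G (f x)))
  }
  where
  isGirardG : IsGirard (reduct (BGirale.girale G))
  isGirardG = Girale.isGirard (BGirale.girale G)
  module E = EmbeddingProperties (BEmbedding.embedding e) isGirardG
  module G≤ = GirardAlgebraOrder _ isGirardG
  open Embedding (BEmbedding.embedding e)
  open IsGirard isGirardG using (⇒-cong)
  open IsLattice (IsGirard.isLattice isGirardG) using (sym; trans) renaming (refl to ≈-refl)

module GiraleProperties {b m} (G : Girale b m) where
  open Girale G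
  open GirardAlgebraOrder ops isGirard using (girardPreorder; ≈⇒≤)
  open GirardPreorderProperties girardPreorder
  open IsLattice (IsGirard.isLattice isGirard) using (sym)

  !-dereliction : ∀ x → ! x ⊑ x
  !-dereliction x = G2 x ⨾ x∧y⊑x x 1#

  !-weakening : ∀ x → ! x ⊑ 1#
  !-weakening x = G2 x ⨾ x∧y⊑y x 1#

  !-mono : ∀ {x y} → x ⊑ y → ! x ⊑ ! y
  !-mono {x} {y} x∧y≈x =
    ≈⇒≤ (!-cong (sym x∧y≈x)) ⨾ ≈⇒≤ (sym (G3 x y)) ⨾ ·-monoˡ _ (!-weakening x) ⨾ 1·x⊑x (! y)

  !-contraction : ∀ x → ! x ⊑ ! x · ! x
  !-contraction x = ≈⇒≤ (!-cong (sym ⊑-refl)) ⨾ ≈⇒≤ (sym (G3 x x))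

  !-digging : ∀ x → ! x ⊑ ! (! x)
  !-digging x = ≈⇒≤ (sym (G4 x))

  !-promotion : ∀ {x y} → ! x ⊑ y → ! x ⊑ ! y
  !-promotion {x} !x⊑y = !-digging x ⨾ !-mono !x⊑y

  !-distrib-⇒ : ∀ x y → ! (x ⇒ y) · ! x ⊑ ! y
  !-distrib-⇒ x y = ≈⇒≤ (G3 _ _) ⨾ !-promotion
    (≈⇒≤ (sym (G3 _ _)) ⨾ ·-mono (!-dereliction _) (!-dereliction x) ⨾ eval x y)

  !-necessitation : ∀ {x} → 1# ⊑ x → 1# ⊑ ! x
  !-necessitation 1⊑x = ≈⇒≤ (sym G1) ⨾ !-mono 1⊑x

module Soundness {b m} (G : BGirale b m)
                 (ρ : ℕ → GirardOps.Carrier (reduct (BGirale.girale G))) where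
  open BGirale G using (girale; ⊤#; top)
  open Girale girale using (ops; isGirard; !)
  open GiraleProperties girale
  open GirardPreorderProperties (GirardAlgebraOrder.girardPreorder ops isGirard)

  ⟦_⟧ : Fm true → Carrier
  ⟦ var n ⟧   = ρ n
  ⟦ `0 ⟧      = 0#
  ⟦ `1 ⟧      = 1#
  ⟦ `⊤ ⟧      = ⊤#
  ⟦ `⊥ ⟧      = ⊤# ⇒ 0#
  ⟦ `¬ φ ⟧    = ⟦ φ ⟧ ⇒ 0#
  ⟦ φ `→ ψ ⟧  = ⟦ φ ⟧ ⇒ ⟦ ψ ⟧
  ⟦ φ `· ψ ⟧  = ⟦ φ ⟧ · ⟦ ψ ⟧
  ⟦ φ `∧ ψ ⟧  = ⟦ φ ⟧ ∧ ⟦ ψ ⟧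
  ⟦ φ `∨ ψ ⟧  = ⟦ φ ⟧ ∨ ⟦ ψ ⟧
  ⟦ `! φ ⟧    = ! ⟦ φ ⟧

  x⊑⊤ : ∀ x → x ⊑ ⊤#
  x⊑⊤ x = externalise (top x)

  axiom-valid : ∀ {φ} → Axiom φ → 1# ⊑ ⟦ φ ⟧
  axiom-valid (HL1 p)      = internalise ⊑-refl
  axiom-valid (HL2 p q r)  = internalise (residual-intro (residual-intro
    (·-rotate _ _ _ ⨾ ·-monoˡ _ (·-comm _ _ ⨾ eval _ _) ⨾ ·-comm _ _ ⨾ eval _ _)))
  axiom-valid (HL3 p q r)  = internalise (⇒-exchange _ _ _)
  axiom-valid (HL4 p)      = internalise (¬¬-elim _)
  axiom-valid (HL5 p q)    = internalise (⇒-exchange _ _ _)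
  axiom-valid (HL6 p q)    = internalise (residual-intro ⊑-refl)
  axiom-valid (HL7 p q r)  =
    internalise (residual-intro (·-assocˡ _ _ _ ⨾ ·-monoˡ _ (eval _ _) ⨾ eval _ _))
  axiom-valid HL8          = ⊑-refl
  axiom-valid (HL9 p)      = internalise (internalise ⊑-refl)
  axiom-valid (HL10 p)     = internalise (¬¬-intro _)
  axiom-valid HL11         = internalise ⊑-refl
  axiom-valid (HL12 p q)   = internalise (x∧y⊑x _ _)
  axiom-valid (HL13 p q)   = internalise (x∧y⊑y _ _)
  axiom-valid (HL14 p q r) = internalise (residual-intro (∧-greatest
    (·-monoˡ _ (x∧y⊑x _ _) ⨾ eval _ _) (·-monoˡ _ (x∧y⊑y _ _) ⨾ eval _ _)))
  axiom-valid (HL15 p q)   = internalise (x⊑x∨y _ _)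
  axiom-valid (HL16 p q)   = internalise (y⊑x∨y _ _)
  axiom-valid (HL17 p q r) = internalise (residual-intro (·-distribˡ-∨ _ _ _ ⨾ ∨-least
    (·-monoˡ _ (x∧y⊑x _ _) ⨾ eval _ _) (·-monoˡ _ (x∧y⊑y _ _) ⨾ eval _ _)))
  axiom-valid (HL18 p)     = internalise (x⊑⊤ _)
  axiom-valid (HL19 p)     = internalise (⇒-mono (x⊑⊤ _) ⊑-refl ⨾ ¬¬-elim _)
  axiom-valid (HL20 p q)   = internalise (residual-intro (·-monoʳ _ (!-weakening _) ⨾ x·1⊑x _))
  axiom-valid (HL21 p q)   = internalise (residual-intro
    (·-monoʳ _ (!-contraction _) ⨾ ·-assocˡ _ _ _ ⨾ ·-monoˡ _ (eval _ _) ⨾ eval _ _))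
  axiom-valid (HL22 p q)   = internalise (residual-intro (!-distrib-⇒ _ _))
  axiom-valid (HL23 p)     = internalise (!-dereliction _)
  axiom-valid (HL24 p)     = internalise (!-digging _)

  sound : ∀ {γ} {H : Fm true → Set γ} → (∀ {ψ} → H ψ → 1# ⊑ ⟦ ψ ⟧) →
          ∀ {ψ} → H ⊢LL ψ → 1# ⊑ ⟦ ψ ⟧
  sound valid (ax α)     = axiom-valid α
  sound valid (hyp h)    = valid h
  sound valid (mp d d′)  = sound valid d ⨾ externalise (sound valid d′)
  sound valid (adj d d′) = ∧-greatest (sound valid d) (sound valid d′)
  sound valid (nec d)    = !-necessitation (sound valid d)

module PhaseSpace {a ℓ} (A : GirardOps a ℓ) (isGirardA : IsGirard A) where
  private
    p : Level
    p = a ⊔ ℓ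
    module A = GirardOps A
    module A≤ = GirardAlgebraOrder A isGirardA
  open GirardPreorderProperties A≤.girardPreorder

  infix 4 _⊥_ _⊑ᴾ_
  infix 30 _ᵒ
  infixr 5 _⇒ᴾ_
  infixl 6 _∨ᴾ_
  infixl 7 _∧ᴾ_
  infixl 8 _·ᴾ_

  _⊥_ : Carrier → Carrier → Set ℓ
  x ⊥ y = x · y ⊑ 0#

  _ᵒ : Pred Carrier p → Pred Carrier p
  (X ᵒ) y = ∀ x → X x → x ⊥ y

  ↓ : Carrier → Pred Carrier p
  ↓ x y = Lift p (y ⊑ x)

  ⊥-sym : ∀ {x y} → x ⊥ y → y ⊥ x
  ⊥-sym {x} {y} x⊥y = ·-comm y x ⨾ x⊥y

  ⊥-downˡ : ∀ {x x′ y} → x′ ⊑ x → x ⊥ y → x′ ⊥ y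
  ⊥-downˡ {y = y} x′⊑x x⊥y = ·-monoˡ y x′⊑x ⨾ x⊥y

  ⊥-downʳ : ∀ {x y y′} → y′ ⊑ y → x ⊥ y → x ⊥ y′
  ⊥-downʳ {x} y′⊑y x⊥y = ·-monoʳ x y′⊑y ⨾ x⊥y

  ⊥-shiftʳ : ∀ {x y z} → x · y ⊥ z → x ⊥ y · z
  ⊥-shiftʳ {x} {y} {z} xy⊥z = ·-assocˡ x y z ⨾ xy⊥z

  ⊥-shiftˡ : ∀ {x y z} → x ⊥ y · z → x · y ⊥ z
  ⊥-shiftˡ {x} {y} {z} x⊥yz = ·-assocʳ x y z ⨾ x⊥yz

  ᵒ-anti : ∀ {X Y} → X ⊆ Y → Y ᵒ ⊆ X ᵒ
  ᵒ-anti X⊆Y Yᵒy x Xx = Yᵒy x (X⊆Y Xx)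

  ⊆ᵒᵒ : ∀ {X} → X ⊆ X ᵒ ᵒ
  ⊆ᵒᵒ Xx y Xᵒy = ⊥-sym (Xᵒy _ Xx)

  ᵒᵒ-least : ∀ {X Z} → X ⊆ Z ᵒ → X ᵒ ᵒ ⊆ Z ᵒ
  ᵒᵒ-least {X} {Z} X⊆Zᵒ Xᵒᵒy = ᵒ-anti {Z} ⊆ᵒᵒ (ᵒ-anti {Z ᵒ ᵒ} (ᵒ-anti X⊆Zᵒ) Xᵒᵒy)

  _⊑ᴾ_ : Pred Carrier p → Pred Carrier p → Set (suc p)
  X ⊑ᴾ Y = Lift (suc p) (Y ᵒ ⊆ X ᵒ)

  ⊆⇒⊑ᴾ : ∀ {X Y} → X ⊆ Y → X ⊑ᴾ Y
  ⊆⇒⊑ᴾ X⊆Y = lift (ᵒ-anti X⊆Y)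

  _∨ᴾ_ _∧ᴾ_ _·ᴾ_ _⇒ᴾ_ : Op₂ (Pred Carrier p)
  X ∨ᴾ Y = X ∪ Y
  X ∧ᴾ Y = (X ᵒ ∪ Y ᵒ) ᵒ
  (X ·ᴾ Y) z = ∃ λ x → ∃ λ y → X x × Y y × z ⊑ x · y
  X ⇒ᴾ Y = (X ·ᴾ Y ᵒ) ᵒ

  1ᴾ 0ᴾ : Pred Carrier p
  1ᴾ = ↓ 1#
  0ᴾ = ↓ 0#

  ·ᴾ-ᵒ-intro : ∀ {X Y w} → (∀ {x y} → X x → Y y → x · y ⊥ w) → ((X ·ᴾ Y) ᵒ) w
  ·ᴾ-ᵒ-intro xy⊥w z (_ , _ , Xx , Yy , z⊑xy) = ⊥-downˡ z⊑xy (xy⊥w Xx Yy)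

  ·ᴾ-ᵒ-elim : ∀ {X Y w x y} → ((X ·ᴾ Y) ᵒ) w → X x → Y y → x · y ⊥ w
  ·ᴾ-ᵒ-elim {x = x} {y} XYᵒw Xx Yy = XYᵒw (x · y) (x , y , Xx , Yy , ⊑-refl)

  ·ᴾ-monoˡ : ∀ {X X′} Y → X ⊑ᴾ X′ → X ·ᴾ Y ⊑ᴾ X′ ·ᴾ Y
  ·ᴾ-monoˡ Y (lift X′ᵒ⊆Xᵒ) = lift λ X′Yᵒw → ·ᴾ-ᵒ-intro λ {x} {y} Xx Yy →
    ⊥-shiftˡ (X′ᵒ⊆Xᵒ (λ x′ X′x′ → ⊥-shiftʳ (·ᴾ-ᵒ-elim X′Yᵒw X′x′ Yy)) x Xx)

  ·ᴾ-comm : ∀ X Y → X ·ᴾ Y ⊑ᴾ Y ·ᴾ X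
  ·ᴾ-comm X Y = lift λ YXᵒw → ·ᴾ-ᵒ-intro λ Xx Yy → ⊥-downˡ (·-comm _ _) (·ᴾ-ᵒ-elim YXᵒw Yy Xx)

  ·ᴾ-assocʳ : ∀ X Y Z → (X ·ᴾ Y) ·ᴾ Z ⊑ᴾ X ·ᴾ (Y ·ᴾ Z)
  ·ᴾ-assocʳ X Y Z = lift λ h → ·ᴾ-ᵒ-intro λ where
    (x , y , Xx , Yy , u⊑xy) Zz → ⊥-downˡ (·-monoˡ _ u⊑xy ⨾ ·-assocʳ x y _)
                                           (·ᴾ-ᵒ-elim h Xx (y , _ , Yy , Zz , ⊑-refl))

  ·ᴾ-assocˡ : ∀ X Y Z → X ·ᴾ (Y ·ᴾ Z) ⊑ᴾ (X ·ᴾ Y) ·ᴾ Z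
  ·ᴾ-assocˡ X Y Z = lift λ h → ·ᴾ-ᵒ-intro λ where
    Xx (y , z , Yy , Zz , v⊑yz) → ⊥-downˡ (·-monoʳ _ v⊑yz ⨾ ·-assocˡ _ y z)
                                           (·ᴾ-ᵒ-elim h (_ , y , Xx , Yy , ⊑-refl) Zz)

  1·ᴾX⊑X : ∀ X → 1ᴾ ·ᴾ X ⊑ᴾ X
  1·ᴾX⊑X X = lift λ Xᵒw → ·ᴾ-ᵒ-intro λ where
    (lift u⊑1) Xx → ⊥-downˡ (·-monoˡ _ u⊑1 ⨾ 1·x⊑x _) (Xᵒw _ Xx)

  X⊑1·ᴾX : ∀ X → X ⊑ᴾ 1ᴾ ·ᴾ X
  X⊑1·ᴾX X = lift λ 1Xᵒw x Xx → ⊥-downˡ (x⊑1·x x) (·ᴾ-ᵒ-elim 1Xᵒw (lift ⊑-refl) Xx)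

  ⇒ᴾ-intro : ∀ {X Y Z} → X ·ᴾ Y ⊑ᴾ Z → X ⊑ᴾ Y ⇒ᴾ Z
  ⇒ᴾ-intro (lift Zᵒ⊆XYᵒ) = lift (ᵒᵒ-least λ where
    (y , c , Yy , Zᵒc , u⊑yc) x Xx → ⊥-downʳ u⊑yc (⊥-shiftʳ (·ᴾ-ᵒ-elim (Zᵒ⊆XYᵒ Zᵒc) Xx Yy)))

  ⇒ᴾ-elim : ∀ {X Y Z} → X ⊑ᴾ Y ⇒ᴾ Z → X ·ᴾ Y ⊑ᴾ Z
  ⇒ᴾ-elim (lift Y⇒Zᵒ⊆Xᵒ) = lift λ {c} Zᵒc → ·ᴾ-ᵒ-intro λ {x} {y} Xx Yy →
    ⊥-shiftˡ (Y⇒Zᵒ⊆Xᵒ (⊆ᵒᵒ (y , c , Yy , Zᵒc , ⊑-refl)) x Xx)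

  ¬¬ᴾ-elim : ∀ X → (X ⇒ᴾ 0ᴾ) ⇒ᴾ 0ᴾ ⊑ᴾ X
  ¬¬ᴾ-elim X = lift λ {c} Xᵒc → ⊆ᵒᵒ
    ( c , 1#
    , ·ᴾ-ᵒ-intro (λ {x} {n} Xx 0ᵒn → ·-swapʳ x n c ⨾ 0ᵒn (x · c) (lift (Xᵒc x Xx)))
    , (λ z (lift z⊑0) → x·1⊑x z ⨾ z⊑0)
    , x⊑x·1 c )

  phasePreorder : GirardPreorder (suc p) (suc p)
  phasePreorder = record
    { Carrier = Pred Carrier p ; _⊑_ = _⊑ᴾ_
    ; _∨_ = _∨ᴾ_ ; _∧_ = _∧ᴾ_ ; _⇒_ = _⇒ᴾ_ ; _·_ = _·ᴾ_ ; 1# = 1ᴾ ; 0# = 0ᴾ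
    ; ⊑-refl = lift λ Xᵒy → Xᵒy
    ; ⊑-trans = λ (lift Yᵒ⊆Xᵒ) (lift Zᵒ⊆Yᵒ) → lift λ Zᵒy → Yᵒ⊆Xᵒ (Zᵒ⊆Yᵒ Zᵒy)
    ; x⊑x∨y = λ X Y → ⊆⇒⊑ᴾ inj₁
    ; y⊑x∨y = λ X Y → ⊆⇒⊑ᴾ inj₂
    ; ∨-least = λ (lift Zᵒ⊆Xᵒ) (lift Zᵒ⊆Yᵒ) → lift λ Zᵒy x →
        [ Zᵒ⊆Xᵒ Zᵒy x , Zᵒ⊆Yᵒ Zᵒy x ]
    ; x∧y⊑x = λ X Y → lift λ Xᵒy → ⊆ᵒᵒ (inj₁ Xᵒy)
    ; x∧y⊑y = λ X Y → lift λ Yᵒy → ⊆ᵒᵒ (inj₂ Yᵒy)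
    ; ∧-greatest = λ (lift Xᵒ⊆Zᵒ) (lift Yᵒ⊆Zᵒ) → lift (ᵒᵒ-least [ Xᵒ⊆Zᵒ , Yᵒ⊆Zᵒ ])
    ; ·-monoˡ = ·ᴾ-monoˡ
    ; ·-comm = ·ᴾ-comm
    ; ·-assocʳ = ·ᴾ-assocʳ
    ; ·-assocˡ = ·ᴾ-assocˡ
    ; 1·x⊑x = 1·ᴾX⊑X
    ; x⊑1·x = X⊑1·ᴾX
    ; residual-intro = ⇒ᴾ-intro
    ; residual-elim = ⇒ᴾ-elim
    ; ¬¬-elim = ¬¬ᴾ-elim
    }

  private
    module P = GirardPreorderProperties phasePreorder
    module Q = GirardPreorderQuotient phasePreorder

  ! : Pred Carrier p → Pred Carrier p
  ! X z = z ⊑ 1# × (X ᵒ ᵒ) 1#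

  !-mono : ∀ {X Y} → X ⊑ᴾ Y → ! X ⊆ ! Y
  !-mono (lift Yᵒ⊆Xᵒ) (z⊑1 , 1∈Xᵒᵒ) = z⊑1 , λ c Yᵒc → 1∈Xᵒᵒ c (Yᵒ⊆Xᵒ Yᵒc)

  !-dereliction : ∀ X → ! X ⊑ᴾ X
  !-dereliction X = lift λ {w} Xᵒw → λ where
    z (z⊑1 , 1∈Xᵒᵒ) → ⊥-downˡ z⊑1 (⊥-sym (1∈Xᵒᵒ w Xᵒw))

  !-weakening : ∀ X → ! X ⊑ᴾ 1ᴾ
  !-weakening X = ⊆⇒⊑ᴾ λ (z⊑1 , _) → lift z⊑1

  !·!⊑!∧ : ∀ X Y → ! X ·ᴾ ! Y ⊑ᴾ ! (X ∧ᴾ Y)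
  !·!⊑!∧ X Y = ⊆⇒⊑ᴾ λ (x , y , (x⊑1 , 1∈Xᵒᵒ) , (y⊑1 , 1∈Yᵒᵒ) , z⊑xy) →
      (z⊑xy ⨾ ·-mono x⊑1 y⊑1 ⨾ 1·x⊑x 1#)
    , ⊆ᵒᵒ (λ c → [ 1∈Xᵒᵒ c , 1∈Yᵒᵒ c ])

  !∧⊑!·! : ∀ X Y → ! (X ∧ᴾ Y) ⊑ᴾ ! X ·ᴾ ! Y
  !∧⊑!·! X Y = ⊆⇒⊑ᴾ λ !XYz@(z⊑1 , _) →
      1# , 1# , (⊑-refl , proj₂ (!-mono (P.x∧y⊑x X Y) !XYz))
    , (⊑-refl , proj₂ (!-mono (P.x∧y⊑y X Y) !XYz)) , (z⊑1 ⨾ x⊑1·x 1#)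

  phaseGirale : Girale (suc p) (suc p)
  phaseGirale = record
    { ops = Q.girardOps
    ; isGirard = Q.isGirard
    ; ! = !
    ; !-cong = λ (X⊑Y , Y⊑X) → ⊆⇒⊑ᴾ (!-mono X⊑Y) , ⊆⇒⊑ᴾ (!-mono Y⊑X)
    ; G1 = !-weakening 1ᴾ , ⊆⇒⊑ᴾ λ (lift z⊑1) → z⊑1 , ⊆ᵒᵒ (lift ⊑-refl)
    ; G2 = λ X → Q.⊑⇒≤ (P.∧-greatest (!-dereliction X) (!-weakening X))
    ; G3 = λ X Y → !·!⊑!∧ X Y , !∧⊑!·! X Y
    ; G4 = λ X → !-dereliction (! X) , ⊆⇒⊑ᴾ λ (z⊑1 , 1∈Xᵒᵒ) → z⊑1 , ⊆ᵒᵒ (⊑-refl , 1∈Xᵒᵒ)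
    }

  ↓ᵒ-elim : ∀ {x y} → ((↓ x) ᵒ) y → x ⊥ y
  ↓ᵒ-elim ↓xᵒy = ↓xᵒy _ (lift ⊑-refl)

  ↓ᵒ-intro : ∀ {x y} → x ⊥ y → ((↓ x) ᵒ) y
  ↓ᵒ-intro x⊥y z (lift z⊑x) = ⊥-downˡ z⊑x x⊥y

  ↓-mono : ∀ {x y} → x ⊑ y → ↓ x ⊆ ↓ y
  ↓-mono x⊑y (lift z⊑x) = lift (z⊑x ⨾ x⊑y)

  x⊥¬x : ∀ x → x ⊥ x ⇒ 0#
  x⊥¬x x = ·-comm x _ ⨾ eval x 0#

  ⊥¬⇒⊑ : ∀ {x z} → z ⊥ x ⇒ 0# → z ⊑ x
  ⊥¬⇒⊑ z⊥¬x = residual-intro z⊥¬x ⨾ ¬¬-elim _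

  ↓-reflects-⊑ : ∀ {x y} → ↓ x ⊑ᴾ ↓ y → x ⊑ y
  ↓-reflects-⊑ {y = y} (lift ↓yᵒ⊆↓xᵒ) = ⊥¬⇒⊑ (↓ᵒ-elim (↓yᵒ⊆↓xᵒ (↓ᵒ-intro (x⊥¬x y))))

  ↓-∨ : ∀ x y → ↓ (x ∨ y) P.≈ ↓ x ∨ᴾ ↓ y
  ↓-∨ x y =
      lift (λ ↓x∪↓yᵒw → ↓ᵒ-intro (residual-elim (∨-least
        (residual-intro (↓ᵒ-elim (ᵒ-anti inj₁ ↓x∪↓yᵒw)))
        (residual-intro (↓ᵒ-elim (ᵒ-anti inj₂ ↓x∪↓yᵒw))))))
    , P.∨-least (⊆⇒⊑ᴾ (↓-mono (x⊑x∨y x y))) (⊆⇒⊑ᴾ (↓-mono (y⊑x∨y x y)))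

  ↓-∧ : ∀ x y → ↓ (x ∧ y) P.≈ ↓ x ∧ᴾ ↓ y
  ↓-∧ x y =
      P.∧-greatest (⊆⇒⊑ᴾ (↓-mono (x∧y⊑x x y))) (⊆⇒⊑ᴾ (↓-mono (x∧y⊑y x y)))
    , ⊆⇒⊑ᴾ λ d∈↓x∧ᴾ↓y → lift (∧-greatest
        (⊥¬⇒⊑ (⊥-sym (d∈↓x∧ᴾ↓y (x ⇒ 0#) (inj₁ (↓ᵒ-intro (x⊥¬x x))))))
        (⊥¬⇒⊑ (⊥-sym (d∈↓x∧ᴾ↓y (y ⇒ 0#) (inj₂ (↓ᵒ-intro (x⊥¬x y)))))))

  ↓-⇒ : ∀ x y → ↓ (x ⇒ y) P.≈ ↓ x ⇒ᴾ ↓ y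
  ↓-⇒ x y =
      ⊆⇒⊑ᴾ (λ (lift z⊑x⇒y) → λ where
        u (x′ , c , lift x′⊑x , ↓yᵒc , u⊑x′c) →
          ·-mono u⊑x′c z⊑x⇒y ⨾ ·-monoˡ (x ⇒ y) (·-monoˡ c x′⊑x) ⨾ ·-rotate x c (x ⇒ y)
          ⨾ ·-monoˡ c (eval x y) ⨾ ↓ᵒ-elim ↓yᵒc)
    , ⊆⇒⊑ᴾ λ {d} d∈↓x⇒ᴾ↓y → lift (residual-intro (⊥¬⇒⊑
        (·-rotate d x (y ⇒ 0#) ⨾ ·-swapʳ (y ⇒ 0#) d x ⨾ ·-monoˡ d (·-comm (y ⇒ 0#) x)
         ⨾ d∈↓x⇒ᴾ↓y (x · (y ⇒ 0#)) (x , y ⇒ 0# , lift ⊑-refl , ↓ᵒ-intro (x⊥¬x y) , ⊑-refl))))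

  ↓-· : ∀ x y → ↓ (x · y) P.≈ ↓ x ·ᴾ ↓ y
  ↓-· x y =
      ⊆⇒⊑ᴾ (λ (lift z⊑xy) → x , y , lift ⊑-refl , lift ⊑-refl , z⊑xy)
    , ⊆⇒⊑ᴾ (λ (_ , _ , lift x′⊑x , lift y′⊑y , z⊑x′y′) → lift (z⊑x′y′ ⨾ ·-mono x′⊑x y′⊑y))

  ↓-embedding : Embedding A (reduct phaseGirale)
  ↓-embedding = record
    { f = ↓
    ; f-cong = λ x≈y → ⊆⇒⊑ᴾ (↓-mono (A≤.≈⇒≤ x≈y)) , ⊆⇒⊑ᴾ (↓-mono (A≤.≈⇒≤ (A≈.sym x≈y)))
    ; injective = λ (↓x⊑↓y , ↓y⊑↓x) → A≤.≤-antisym (↓-reflects-⊑ ↓x⊑↓y) (↓-reflects-⊑ ↓y⊑↓x)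
    ; f-∨ = ↓-∨
    ; f-∧ = ↓-∧
    ; f-⇒ = ↓-⇒
    ; f-· = ↓-·
    ; f-1 = P.≈-refl
    ; f-0 = P.≈-refl
    }
    where module A≈ = IsLattice (IsGirard.isLattice isGirardA)

module BoundedPhaseSpace {a ℓ} (B : BGirardOps a ℓ) (isBGirardB : IsBGirard B) where
  open BGirardOps B using (ops; ⊤#)
  open IsBGirard isBGirardB using (isGirard; top)
  open PhaseSpace ops isGirard
  open GirardPreorderProperties (GirardAlgebraOrder.girardPreorder ops isGirard)
  private
    module P = GirardPreorderProperties phasePreorder
    module Q = GirardPreorderQuotient phasePreorder

  X⊑ᴾ↓⊤ : ∀ X → X ⊑ᴾ ↓ ⊤#
  X⊑ᴾ↓⊤ X = lift λ ↓⊤ᵒy x Xx → ⊥-downˡ (externalise (top x)) (↓ᵒ-elim ↓⊤ᵒy)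

  phaseBGirale : BGirale (suc (a ⊔ ℓ)) (suc (a ⊔ ℓ))
  phaseBGirale = record
    { girale = phaseGirale ; ⊤# = ↓ ⊤# ; top = λ X → Q.⊑⇒≤ (P.internalise (X⊑ᴾ↓⊤ X)) }

  ↓-bembedding : BEmbedding B (breduct phaseBGirale)
  ↓-bembedding = record { embedding = ↓-embedding ; f-⊤ = P.≈-refl }

ι-axiom : ∀ {φ : Fm false} → Axiom φ → Axiom (ι φ)
ι-axiom (HL1 p)      = HL1 (ι p)
ι-axiom (HL2 p q r)  = HL2 (ι p) (ι q) (ι r)
ι-axiom (HL3 p q r)  = HL3 (ι p) (ι q) (ι r)
ι-axiom (HL4 p)      = HL4 (ι p)
ι-axiom (HL5 p q)    = HL5 (ι p) (ι q)
ι-axiom (HL6 p q)    = HL6 (ι p) (ι q)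
ι-axiom (HL7 p q r)  = HL7 (ι p) (ι q) (ι r)
ι-axiom HL8          = HL8
ι-axiom (HL9 p)      = HL9 (ι p)
ι-axiom (HL10 p)     = HL10 (ι p)
ι-axiom HL11         = HL11
ι-axiom (HL12 p q)   = HL12 (ι p) (ι q)
ι-axiom (HL13 p q)   = HL13 (ι p) (ι q)
ι-axiom (HL14 p q r) = HL14 (ι p) (ι q) (ι r)
ι-axiom (HL15 p q)   = HL15 (ι p) (ι q)
ι-axiom (HL16 p q)   = HL16 (ι p) (ι q)
ι-axiom (HL17 p q r) = HL17 (ι p) (ι q) (ι r)
ι-axiom (HL18 p)     = HL18 (ι p)
ι-axiom (HL19 p)     = HL19 (ι p)

ι-derivation : ∀ {γ} {Γ : Fm false → Set γ} {φ} → Γ ⊢MALL φ → ιSet Γ ⊢LL ι φ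
ι-derivation (ax α)     = ax (ι-axiom α)
ι-derivation (hyp h)    = hyp (_ , h , refl)
ι-derivation (mp d d′)  = mp (ι-derivation d) (ι-derivation d′)
ι-derivation (adj d d′) = adj (ι-derivation d) (ι-derivation d′)

module Lindenbaum {γ} (Γ : Fm false → Set γ) where
  infix 4 _≼_
  _≼_ : Fm false → Fm false → Set γ
  φ ≼ ψ = Γ ⊢MALL φ `→ ψ

  ≼-refl : ∀ {φ} → φ ≼ φ
  ≼-refl = ax (HL1 _)

  infixr 4 _⨾_
  _⨾_ : ∀ {φ ψ χ} → φ ≼ ψ → ψ ≼ χ → φ ≼ χ
  φ≼ψ ⨾ ψ≼χ = mp ψ≼χ (mp φ≼ψ (ax (HL2 _ _ _)))

  exchange : ∀ {φ ψ χ} → Γ ⊢MALL φ `→ (ψ `→ χ) → Γ ⊢MALL ψ `→ (φ `→ χ)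
  exchange d = mp d (ax (HL3 _ _ _))

  1≼ : ∀ {φ} → Γ ⊢MALL φ → `1 ≼ φ
  1≼ d = mp d (exchange (ax (HL9 _)))

  1→φ≼φ : ∀ {φ} → (`1 `→ φ) ≼ φ
  1→φ≼φ = mp (ax HL8) (exchange (ax (HL1 _)))

  →-monoʳ : ∀ {φ ψ χ} → φ ≼ ψ → (χ `→ φ) ≼ (χ `→ ψ)
  →-monoʳ φ≼ψ = mp φ≼ψ (exchange (ax (HL2 _ _ _)))

  →-antiˡ : ∀ {φ ψ χ} → φ ≼ ψ → (ψ `→ χ) ≼ (φ `→ χ)
  →-antiˡ φ≼ψ = mp φ≼ψ (ax (HL2 _ _ _))

  residual-intro : ∀ {φ ψ χ} → φ `· ψ ≼ χ → φ ≼ (ψ `→ χ)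
  residual-intro φψ≼χ = ax (HL6 _ _) ⨾ →-monoʳ φψ≼χ

  residual-elim : ∀ {φ ψ χ} → φ ≼ (ψ `→ χ) → φ `· ψ ≼ χ
  residual-elim φ≼ψ→χ = mp φ≼ψ→χ (ax (HL7 _ _ _))

  curry : ∀ {φ ψ χ} → (φ `· ψ `→ χ) ≼ (φ `→ (ψ `→ χ))
  curry = exchange (ax (HL6 _ _) ⨾ →-monoʳ (exchange (ax (HL1 _))) ⨾ ax (HL3 _ _ _))

  ¬≼→0 : ∀ {φ} → `¬ φ ≼ (φ `→ `0)
  ¬≼→0 = exchange (ax (HL10 _))

  →0≼¬ : ∀ {φ} → (φ `→ `0) ≼ `¬ φ
  →0≼¬ = →-monoʳ 0≼¬1 ⨾ ax (HL5 _ `1) ⨾ 1→φ≼φ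
    where
    0≼¬1 : `0 ≼ `¬ `1
    0≼¬1 = mp (1≼ (ax HL11)) (ax (HL5 `1 `0))

  ¬-anti : ∀ {φ ψ} → φ ≼ ψ → `¬ ψ ≼ `¬ φ
  ¬-anti φ≼ψ = ¬≼→0 ⨾ →-antiˡ φ≼ψ ⨾ →0≼¬

  lindenbaumPreorder : GirardPreorder 0ℓ γ
  lindenbaumPreorder = record
    { Carrier = Fm false ; _⊑_ = _≼_
    ; _∨_ = _`∨_ ; _∧_ = _`∧_ ; _⇒_ = _`→_ ; _·_ = _`·_ ; 1# = `1 ; 0# = `0
    ; ⊑-refl = ≼-refl ; ⊑-trans = _⨾_
    ; x⊑x∨y = λ φ ψ → ax (HL15 φ ψ)
    ; y⊑x∨y = λ φ ψ → ax (HL16 φ ψ)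
    ; ∨-least = λ φ≼χ ψ≼χ → mp (adj φ≼χ ψ≼χ) (ax (HL17 _ _ _))
    ; x∧y⊑x = λ φ ψ → ax (HL12 φ ψ)
    ; x∧y⊑y = λ φ ψ → ax (HL13 φ ψ)
    ; ∧-greatest = λ χ≼φ χ≼ψ → mp (adj χ≼φ χ≼ψ) (ax (HL14 _ _ _))
    ; ·-monoˡ = λ ψ φ≼φ′ → residual-elim (φ≼φ′ ⨾ ax (HL6 _ _))
    ; ·-comm = λ φ ψ → residual-elim (exchange (ax (HL6 _ _)))
    ; ·-assocʳ = λ φ ψ χ → residual-elim (residual-elim (ax (HL6 _ _) ⨾ curry))
    ; ·-assocˡ = λ φ ψ χ → residual-elim (ax (HL6 _ _) ⨾ →-monoʳ (ax (HL6 _ _)) ⨾ ax (HL7 _ _ _))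
    ; 1·x⊑x = λ φ → residual-elim (ax (HL9 φ))
    ; x⊑1·x = λ φ → mp (ax HL8) (ax (HL6 `1 φ))
    ; residual-intro = residual-intro
    ; residual-elim = residual-elim
    ; ¬¬-elim = λ φ → →-antiˡ ¬≼→0 ⨾ →0≼¬ ⨾ ax (HL4 φ)
    }

  open GirardPreorderQuotient lindenbaumPreorder public using (isGirard; ≤⇒⊑; ⊑⇒≤)

  lindenbaum : BGirardOps 0ℓ γ
  lindenbaum = record { ops = GirardPreorderQuotient.girardOps lindenbaumPreorder ; ⊤# = `⊤ }

  isBGirard : IsBGirard lindenbaum
  isBGirard = record { isGirard = isGirard ; top = λ φ → ⊑⇒≤ (1≼ (ax (HL18 φ))) }

module Conservativity {γ} (Γ : Fm false → Set γ) where
  open Lindenbaum Γ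
  private
    module L = GirardPreorderProperties lindenbaumPreorder

  φ→0≈¬φ : ∀ φ → (φ `→ `0) L.≈ `¬ φ
  φ→0≈¬φ φ = →0≼¬ , ¬≼→0

  ⊤→0≈⊥ : (`⊤ `→ `0) L.≈ `⊥
  ⊤→0≈⊥ = (→0≼¬ ⨾ ¬-anti (ax (HL18 (`¬ `⊥))) ⨾ ax (HL4 `⊥)) , ax (HL19 _)

  module _ {b m} (G : BGirale b m) (e : BEmbedding lindenbaum (breduct G)) where
    private
      isGirardG : IsGirard (reduct (BGirale.girale G))
      isGirardG = Girale.isGirard (BGirale.girale G)
      module G≤ = GirardAlgebraOrder _ isGirardG
      module E = EmbeddingProperties (BEmbedding.embedding e) isGirardG
    open Embedding (BEmbedding.embedding e)
    open BEmbedding e using (f-⊤)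
    open Soundness G (λ n → f (var n))
    open GirardOps (reduct (BGirale.girale G)) using (_≈_; _≤_; 1#)
    open IsGirard isGirardG using (⇒-cong)
    open IsLattice (IsGirard.isLattice isGirardG) using (sym; trans; ∨-cong; ∧-cong)
      renaming (refl to ≈-refl)
    open IsCommutativeMonoid (IsGirard.isCommutativeMonoid isGirardG) using ()
      renaming (∙-cong to ·-cong)

    ⟦ι⟧≈f : ∀ φ → ⟦ ι φ ⟧ ≈ f φ
    ⟦ι⟧≈f (var n)  = ≈-refl
    ⟦ι⟧≈f `0       = sym f-0
    ⟦ι⟧≈f `1       = sym f-1
    ⟦ι⟧≈f `⊤       = sym f-⊤
    ⟦ι⟧≈f `⊥       = trans (⇒-cong (sym f-⊤) (sym f-0))
                           (trans (sym (f-⇒ `⊤ `0)) (f-cong ⊤→0≈⊥))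
    ⟦ι⟧≈f (`¬ φ)   = trans (⇒-cong (⟦ι⟧≈f φ) (sym f-0))
                           (trans (sym (f-⇒ φ `0)) (f-cong (φ→0≈¬φ φ)))
    ⟦ι⟧≈f (φ `→ ψ) = trans (⇒-cong (⟦ι⟧≈f φ) (⟦ι⟧≈f ψ)) (sym (f-⇒ φ ψ))
    ⟦ι⟧≈f (φ `· ψ) = trans (·-cong (⟦ι⟧≈f φ) (⟦ι⟧≈f ψ)) (sym (f-· φ ψ))
    ⟦ι⟧≈f (φ `∧ ψ) = trans (∧-cong (⟦ι⟧≈f φ) (⟦ι⟧≈f ψ)) (sym (f-∧ φ ψ))
    ⟦ι⟧≈f (φ `∨ ψ) = trans (∨-cong (⟦ι⟧≈f φ) (⟦ι⟧≈f ψ)) (sym (f-∨ φ ψ))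

    1≼⇒valid : ∀ {φ} → `1 ≼ φ → 1# ≤ ⟦ ι φ ⟧
    1≼⇒valid {φ} 1≼φ = G≤.≤-resp-≈ f-1 (sym (⟦ι⟧≈f φ)) (E.f-mono (⊑⇒≤ 1≼φ))

    valid⇒1≼ : ∀ {φ} → 1# ≤ ⟦ ι φ ⟧ → `1 ≼ φ
    valid⇒1≼ {φ} valid = ≤⇒⊑ (E.f-reflects-≤ (G≤.≤-resp-≈ (sym f-1) (⟦ι⟧≈f φ) valid))

    ⊢LL⇒1≼ : ∀ {φ} → ιSet Γ ⊢LL ι φ → `1 ≼ φ
    ⊢LL⇒1≼ d = valid⇒1≼ (sound (λ where (_ , γ , refl) → 1≼⇒valid (1≼ (hyp γ))) d)

  conservative : ∀ {φ} → ιSet Γ ⊢LL ι φ → Γ ⊢MALL φ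
  conservative d = mp (ax HL8) (⊢LL⇒1≼ phaseBGirale ↓-bembedding d)
    where open BoundedPhaseSpace lindenbaum isBGirard

mainTheorem12 : ∀ {a ℓ b m γ : Level} →
    -- Girard algebras: A is a Girard algebra iff it embeds into the
    -- Girard-algebra reduct of some girale
    (∀ (A : GirardOps a ℓ) →
       IsGirard A ⇔ Σ (Girale (suc (a ⊔ ℓ)) (suc (a ⊔ ℓ))) (λ G → Embedding A (reduct G)))
    -- every subalgebra (embedded copy) of a reduct of a girale (any size) is a Girard algebra
    × (∀ (A : GirardOps a ℓ) (G : Girale b m) → Embedding A (reduct G) → IsGirard A)
    -- bounded versions
    × (∀ (B : BGirardOps a ℓ) →
       IsBGirard B ⇔ Σ (BGirale (suc (a ⊔ ℓ)) (suc (a ⊔ ℓ))) (λ G → BEmbedding B (breduct G)))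
    × (∀ (B : BGirardOps a ℓ) (G : BGirale b m) → BEmbedding B (breduct G) → IsBGirard B)
    -- LL is a conservative extension of MALL
    × (∀ (Γ : Fm false → Set γ) (φ : Fm false) → (ιSet Γ ⊢LL ι φ) ⇔ (Γ ⊢MALL φ))
mainTheorem12 =
    (λ A → mk⇔ (λ isGirardA → phaseGirale A isGirardA , ↓-embedding A isGirardA)
               (λ (G , e) → embedding⇒isGirard G e))
  , (λ A → embedding⇒isGirard)
  , (λ B → mk⇔ (λ isBGirardB → phaseBGirale B isBGirardB , ↓-bembedding B isBGirardB)
               (λ (G , e) → bembedding⇒isBGirard G e))
  , (λ B → bembedding⇒isBGirard)
  , (λ Γ φ → mk⇔ (Conservativity.conservative Γ) ι-derivation)
  where
  open PhaseSpace using (phaseGirale; ↓-embedding)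
  open BoundedPhaseSpace using (phaseBGirale; ↓-bembedding)
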